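{- For every integer $n\geq0$, $$P_n(2y+3)=U_n(y)+U_{n-1}(y),\qquad Q_n(2y+3)=U_n(y).$$
   Context: Fibonacci product polynomials: for $n\geq1$, $P_n(x)$ is the characteristic polynomial $\det(xI-M)$ of the $n\times n$ tridiagonal matrix with all sub- and superdiagonal entries $1$ and diagonal $(2,3,\dots,3)$, and $Q_n(x)$ that of the $n\times n$ tridiagonal matrix with sub- and superdiagonal entries $1$ and all diagonal entries $3$; $P_0=Q_0=1$. Chebyshev polynomials of the second kind: $U_0=1$, $U_1(y)=2y$, $U_{n+1}=2yU_n-U_{n-1}$, and $U_{ -1}=0$. -}

module Defs where

open import Level using (_⊔_)
open import Algebra.Bundles using (CommutativeRing)
open import Data.Nat as ℕ using (ℕ; zero; suc; _≡ᵇ_)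
open import Data.Fin using (Fin; zero; suc; toℕ; punchIn)
open import Data.Bool using (Bool; true; false; if_then_else_; _∨_)

module _ {c ℓ} (R : CommutativeRing c ℓ) where
  open CommutativeRing R using (Carrier; _+_; _*_; _-_; 0#; 1#)

  two three : Carrier
  two = 1# + 1#
  three = 1# + 1# + 1#

  Matrix : ℕ → Set c
  Matrix n = Fin n → Fin n → Carrier

  altSum : ∀ {n} → (Fin n → Carrier) → Carrier
  altSum {zero} f = 0#
  altSum {suc n} f = f zero - altSum (λ j → f (suc j))

  minor : ∀ {n} → Matrix (suc n) → Fin (suc n) → Matrix n
  minor A j i k = A (suc i) (punchIn j k)

  det : ∀ {n} → Matrix n → Carrier
  det {zero} A = 1#
  det {suc n} A = altSum (λ j → A zero j * det (minor A j))

  charMatrix : ∀ {n} → Carrier → Matrix n → Matrix n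
  charMatrix x M i j = (if toℕ i ≡ᵇ toℕ j then x else 0#) - M i j

  charPoly : ∀ {n} → Matrix n → Carrier → Carrier
  charPoly M x = det (charMatrix x M)

  tridiag : ∀ {n} → (Fin n → Carrier) → Matrix n
  tridiag d i j =
    if toℕ i ≡ᵇ toℕ j then d i
    else (if (suc (toℕ i) ≡ᵇ toℕ j) ∨ (suc (toℕ j) ≡ᵇ toℕ i) then 1# else 0#)

  diagP : ∀ {n} → Fin n → Carrier
  diagP zero = two
  diagP (suc _) = three

  diagQ : ∀ {n} → Fin n → Carrier
  diagQ _ = three

  MP MQ : (n : ℕ) → Matrix n
  MP n = tridiag diagP
  MQ n = tridiag diagQ

  -- P_n(x), Q_n(x)   (P_0 = Q_0 = 1 since det of the empty matrix is 1)
  P Q : ℕ → Carrier → Carrier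
  P n x = charPoly (MP n) x
  Q n x = charPoly (MQ n) x

  U : ℕ → Carrier → Carrier
  U zero y = 1#
  U (suc zero) y = two * y
  U (suc (suc n)) y = two * y * U (suc n) y - U n y

  -- U_{n-1}, with U_{-1} = 0
  Uprev : ℕ → Carrier → Carrier
  Uprev zero y = 0#
  Uprev (suc n) y = U n y

-- Expanding det(xI - T) along the first row shows that the characteristic polynomials D_n of the
-- tridiagonal matrices with diagonal (d₀, d₁, …) obey D_n = (x - d₀) D_{n-1} - D_{n-2}.  At
-- x = 2y + 3 the constant diagonal 3 turns this into the Chebyshev recurrence U_n = 2y U_{n-1} - U_{n-2}
-- with the same initial values, so Q_n = U_n; for P_n only the first step changes, to
-- (2y + 1) U_{n-1} - U_{n-2} = U_n + U_{n-1}.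
module Submission where

open import Defs
open import Algebra.Bundles using (CommutativeRing)
open import Data.Nat using (ℕ; zero; suc)
open import Data.Product using (_×_; _,_)
open import Data.Fin using (Fin; zero; suc; punchOut)
open import Data.Fin.Properties using (_≟_; punchIn-punchOut)
open import Data.Maybe using (nothing)
open import Function using (_∘_)
open import Relation.Nullary using (yes; no)
import Relation.Binary.PropositionalEquality as ≡
import Algebra.Properties.Ring as RingProperties
import Relation.Binary.Reasoning.Setoid as SetoidReasoning
import Tactic.RingSolver.NonReflective as RingSolver
open import Tactic.RingSolver.Core.AlmostCommutativeRing using (fromCommutativeRing)

module _ {c ℓ} (R : CommutativeRing c ℓ) where
  open CommutativeRing R hiding (zero)
  open RingProperties ring using (-0#≈0#; -1*x≈-x; -‿involutive)
  open RingSolver (fromCommutativeRing R (λ _ → nothing)) using (solve; _⊜_; _⊕_; _⊗_; ⊝_)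
  open SetoidReasoning setoid

  x-0#≈x : ∀ x → x - 0# ≈ x
  x-0#≈x x = trans (+-congˡ -0#≈0#) (+-identityʳ x)

  x+y-y≈x : ∀ x y → x + y - y ≈ x
  x+y-y≈x x y = trans (+-assoc x y (- y)) (trans (+-congˡ (-‿inverseʳ y)) (+-identityʳ x))

  x+[y+z]-y≈x+z : ∀ x y z → x + (y + z) - y ≈ x + z
  x+[y+z]-y≈x+z x y z = trans (+-congʳ (x+[y+z]≈[x+z]+y x y z)) (x+y-y≈x (x + z) y)
    where
    x+[y+z]≈[x+z]+y : ∀ x y z → x + (y + z) ≈ (x + z) + y
    x+[y+z]≈[x+z]+y = solve 3 (λ x y z → (x ⊕ (y ⊕ z)) ⊜ ((x ⊕ z) ⊕ y)) refl

  [x+y]*z-w≈[x*z-w]+y*z : ∀ x y z w → (x + y) * z - w ≈ (x * z - w) + y * z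
  [x+y]*z-w≈[x*z-w]+y*z = solve 4 (λ x y z w → ((x ⊕ y) ⊗ z ⊕ ⊝ w) ⊜ ((x ⊗ z ⊕ ⊝ w) ⊕ y ⊗ z)) refl

  [0-1]*[[0-1]*x]≈x : ∀ x → (0# - 1#) * ((0# - 1#) * x) ≈ x
  [0-1]*[[0-1]*x]≈x x = begin
    (0# - 1#) * ((0# - 1#) * x) ≈⟨ *-cong (+-identityˡ _) (*-congʳ (+-identityˡ _)) ⟩
    - 1# * (- 1# * x)           ≈⟨ *-congˡ (-1*x≈-x x) ⟩
    - 1# * - x                  ≈⟨ -1*x≈-x (- x) ⟩
    - - x                       ≈⟨ -‿involutive x ⟩
    x                           ∎

  altSum-≈0 : ∀ {n} (f : Fin n → Carrier) → (∀ j → f j ≈ 0#) → altSum R f ≈ 0#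
  altSum-≈0 {zero}  f f≈0 = refl
  altSum-≈0 {suc n} f f≈0 = begin
    f zero - altSum R (f ∘ suc) ≈⟨ +-cong (f≈0 zero) (-‿cong (altSum-≈0 (f ∘ suc) (f≈0 ∘ suc))) ⟩
    0# - 0#                     ≈⟨ -‿inverseʳ 0# ⟩
    0#                          ∎

  det₁ : (A : Matrix R 1) → det R A ≈ A zero zero
  det₁ A = trans (x-0#≈x _) (*-identityʳ _)

  det-zeroColumn : ∀ {n} (A : Matrix R n) (k : Fin n) → (∀ i → A i k ≈ 0#) → det R A ≈ 0#
  det-zeroColumn {suc n} A k Aik≈0 = altSum-≈0 _ term≈0
    where
    term≈0 : ∀ j → A zero j * det R (minor R A j) ≈ 0#
    term≈0 j with j ≟ k
    ... | yes ≡.refl = trans (*-congʳ (Aik≈0 zero)) (zeroˡ _)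
    ... | no j≢k   = trans (*-congˡ (det-zeroColumn (minor R A j) (punchOut j≢k) minor≈0)) (zeroʳ _)
      where
      minor≈0 : ∀ i → minor R A j i (punchOut j≢k) ≈ 0#
      minor≈0 i = trans (reflexive (≡.cong (A (suc i)) (punchIn-punchOut j≢k))) (Aik≈0 (suc i))

  det-firstColumnZeroBelow : ∀ {n} (A : Matrix R (suc n)) → (∀ i → A (suc i) zero ≈ 0#) →
    det R A ≈ A zero zero * det R (minor R A zero)
  det-firstColumnZeroBelow {zero}  A _      = x-0#≈x _
  det-firstColumnZeroBelow {suc n} A Ai0≈0 = begin
    A zero zero * det R (minor R A zero) - altSum R rest ≈⟨ +-congˡ (-‿cong (altSum-≈0 rest rest≈0)) ⟩
    A zero zero * det R (minor R A zero) - 0#            ≈⟨ x-0#≈x _ ⟩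
    A zero zero * det R (minor R A zero)                 ∎
    where
    rest : Fin (suc n) → Carrier
    rest j = A zero (suc j) * det R (minor R A (suc j))
    rest≈0 : ∀ j → rest j ≈ 0#
    rest≈0 j = trans (*-congˡ (det-zeroColumn (minor R A (suc j)) zero Ai0≈0)) (zeroʳ _)

  det-firstRowZeroBeyondTwo : ∀ {n} (A : Matrix R (suc (suc n))) → (∀ j → A zero (suc (suc j)) ≈ 0#) →
    det R A ≈ A zero zero * det R (minor R A zero) - A zero (suc zero) * det R (minor R A (suc zero))
  det-firstRowZeroBeyondTwo A A0j≈0 =
    +-congˡ (-‿cong (trans (+-congˡ (-‿cong (altSum-≈0 _ rest≈0))) (x-0#≈x _)))
    where
    rest≈0 : ∀ j → A zero (suc (suc j)) * det R (minor R A (suc (suc j))) ≈ 0#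
    rest≈0 j = trans (*-congʳ (A0j≈0 j)) (zeroˡ _)

  charTridiag : ∀ {n} → Carrier → (Fin n → Carrier) → Matrix R n
  charTridiag x d = charMatrix R x (tridiag R d)

  det-charTridiag-recurrence : ∀ {n} x (d : Fin (suc (suc n)) → Carrier) →
    det R (charTridiag x d) ≈
      (x - d zero) * det R (charTridiag x (λ i → d (suc i))) - det R (charTridiag x (λ i → d (suc (suc i))))
  det-charTridiag-recurrence x d = begin
    det R A
      ≈⟨ det-firstRowZeroBeyondTwo A (λ _ → -‿inverseʳ 0#) ⟩
    (x - d zero) * D′ - (0# - 1#) * det R (minor R A (suc zero))
      ≈⟨ +-congˡ (-‿cong (*-congˡ cofactor)) ⟩
    (x - d zero) * D′ - (0# - 1#) * ((0# - 1#) * D″)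
      ≈⟨ +-congˡ (-‿cong ([0-1]*[[0-1]*x]≈x D″)) ⟩
    (x - d zero) * D′ - D″ ∎
    where
    A  = charTridiag x d
    D′ = det R (charTridiag x (λ i → d (suc i)))
    D″ = det R (charTridiag x (λ i → d (suc (suc i))))
    -- the (0,1)-minor has first column (-1, 0, …, 0)ᵀ, and deleting it leaves the matrix for d₂, d₃, …
    cofactor : det R (minor R A (suc zero)) ≈ (0# - 1#) * D″
    cofactor = det-firstColumnZeroBelow (minor R A (suc zero)) (λ _ → -‿inverseʳ 0#)

  module _ (y : Carrier) where

    det-charTridiag-const≈U : ∀ (c : Carrier) n → det R (charTridiag {n} (two R * y + c) (λ _ → c)) ≈ U R n y
    det-charTridiag-const≈U c zero          = refl
    det-charTridiag-const≈U c (suc zero)    =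
      trans (det₁ (charTridiag (two R * y + c) (λ _ → c))) (x+y-y≈x (two R * y) c)
    det-charTridiag-const≈U c (suc (suc n)) = trans (det-charTridiag-recurrence {n} (two R * y + c) (λ _ → c))
      (+-cong (*-cong (x+y-y≈x (two R * y) c) (det-charTridiag-const≈U c (suc n)))
              (-‿cong (det-charTridiag-const≈U c n)))

    -- three R unfolds to two R + 1#, which is what makes x+[y+z]-y≈x+z applicable below
    det-charTridiag-diagP≈U+Uprev : ∀ n →
      det R (charTridiag {n} (two R * y + three R) (diagP R)) ≈ U R n y + Uprev R n y
    det-charTridiag-diagP≈U+Uprev zero          = sym (+-identityʳ 1#)
    det-charTridiag-diagP≈U+Uprev (suc zero)    =
      trans (det₁ (charTridiag (two R * y + three R) (diagP R))) (x+[y+z]-y≈x+z (two R * y) (two R) 1#)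
    det-charTridiag-diagP≈U+Uprev (suc (suc n)) = begin
      det R (charTridiag {suc (suc n)} (two R * y + three R) (diagP R))
        ≈⟨ det-charTridiag-recurrence {n} (two R * y + three R) (diagP R) ⟩
      (two R * y + three R - two R) * det R (charTridiag {suc n} (two R * y + three R) (λ _ → three R))
        - det R (charTridiag {n} (two R * y + three R) (λ _ → three R))
        ≈⟨ +-cong (*-cong (x+[y+z]-y≈x+z (two R * y) (two R) 1#) (det-charTridiag-const≈U (three R) (suc n)))
                  (-‿cong (det-charTridiag-const≈U (three R) n)) ⟩
      (two R * y + 1#) * U R (suc n) y - U R n y
        ≈⟨ [x+y]*z-w≈[x*z-w]+y*z (two R * y) 1# (U R (suc n) y) (U R n y) ⟩
      U R (suc (suc n)) y + 1# * U R (suc n) y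
        ≈⟨ +-congˡ (*-identityˡ _) ⟩
      U R (suc (suc n)) y + U R (suc n) y ∎

proposition4p10 : ∀ {c ℓ} (R : CommutativeRing c ℓ) (n : ℕ) (y : CommutativeRing.Carrier R) →
    let open CommutativeRing R in
    (P R n (two R * y + three R) ≈ U R n y + Uprev R n y)
    × (Q R n (two R * y + three R) ≈ U R n y)
proposition4p10 R n y = det-charTridiag-diagP≈U+Uprev R y n , det-charTridiag-const≈U R y (three R) n
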